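{- Let $n=p^\ell m$, where $p$ is a prime and $\ell\geq 1$, $m\geq 2$ are integers, and let $\mathrm{Cay}(\mathbb{Z}_n,S)$ be a connected circulant graph of order $n$ and degree $p^\ell-1$. Assume that $S_0$ is pyramidal, with associated sequences $\mathbf{h}(S_0) = (h_0, h_1, \ldots, h_t)$ and $\mathbf{k}(S_0) = (k_0, k_1, \ldots, k_t)$. Then the number $c(S)$ of distinct perfect codes containing $0$ in $\mathrm{Cay}(\mathbb{Z}_n,S)$ satisfies $$c(S)\ge p^{\left(\sum_{i=0}^{t-1}(h_{i-1}-h_{i})k_{i}\right)+h_{t-1}-\ell},$$ where $h_{ -1} = \ell$.
   Context: Groups are additive; $\mathrm{Cay}(\mathbb{Z}_n,S)$ (with $S=-S\subseteq\mathbb{Z}_n\setminus\{0\}$) has $x\sim y$ iff $x-y\in S$; $S_0=S\cup\{0\}$. A perfect code is a vertex set $D$ such that every vertex is at distance at most $1$ from exactly one vertex of $D$. For a subgroup $H$ and $X\subseteq G$, $X/H=\{x+H:x\in X\}$. A nonzero $a$ with $X+a=X$ is a period of $X$; periods with $0$ form the subgroup of periods; $X$ is periodic if this subgroup is nontrivial, aperiodic otherwise, and $K$-periodic if $K$ (nontrivial) is its subgroup of periods. Pyramidal set: $X\subseteq G$ with $0\in X$ is pyramidal if there is a series $H_0<H_1<\cdots<H_{2t-1}\le H_{2t}=G$, $t\ge1$, such that either (a) $H_0=\{0\}$, $X$ aperiodic, and (T1) $(X/H_{2i}-X/H_{2i})\cap(H_{2i+1}/H_{2i})=\{0\}$ for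 $0\le i\le t-1$; (T2) $X/H_{2i-1}$ is $(H_{2i}/H_{2i-1})$-periodic for $1\le i\le t$; (T3) $|X/H_{2t-1}|=|G/H_{2t-1}|$ and $|X/H_{2i}|=|X/H_{2i+1}|$ for $0\le i\le t-1$; or (b) $H_0\ne\{0\}$, $X$ is $H_0$-periodic and $X/H_0$ satisfies (T1)–(T3) in $G/H_0$ with respect to the series $H_i/H_0$. Such a series is an admissible subgroup series of length $2t$ associated with $X$. Associated sequences: for pyramidal $S_0$ with $|S_0|=p^\ell$ in $\mathbb{Z}_n$, let $H_0<H_1<\cdots<H_{2t-1}\le H_{2t}=\mathbb{Z}_n$ be the longest admissible subgroup series associated with $S_0$ (the paper shows it is unique). Set $k_0=m$ and let $h_0$ be such that $H_0=\langle p^{h_0}m\rangle$ (so $h_0=\ell$ if $S_0$ is aperiodic, $h_0<\ell$ if periodic); for $1\le i\le t$ let $k_i=k_{i-1}/|H_{2i-1}/H_{2i-2}|$ and $h_i=h_{i-1}-\log_p|H_{2i}/H_{2i-1}|$, so that $H_{2i-1}=\langle p^{h_{i-1}}k_i\rangle$, $H_{2i}=\langle p^{h_i}k_i\rangle$, $k_t=1$, $h_t=0$. -}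

module Defs where

open import Data.Bool using (Bool; true; false; _∧_; _∨_; if_then_else_)
open import Data.Bool.Properties using () renaming (_≟_ to _≟ᵇ_)
open import Data.Nat using (ℕ; zero; suc; _+_; _*_; _∸_; _^_; _≤_; _<_; _≡ᵇ_)
open import Data.Nat.Properties using (_≟_)
open import Data.Nat.DivMod using (_%_)
open import Data.Nat.Divisibility using (_∣_)
open import Data.Fin using (Fin; toℕ)
open import Data.Fin.Properties using (all?)
open import Data.List using (List; []; _∷_; _++_; map; filter; length)
open import Data.Product using (Σ; ∃; _×_; _,_)
open import Data.Sum using (_⊎_)
open import Relation.Binary.PropositionalEquality using (_≡_; _≢_)
open import Relation.Nullary using (Dec; _×-dec_)

-- Z_N is represented by the naturals 0,…,N-1 with arithmetic mod N.
-- A subset of Z_N is a characteristic function  ℕ → Bool ; only its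
-- values on 0,…,N-1 are ever consulted.
-- Every subgroup of the cyclic group Z_N is  ⟨e⟩ = {multiples of e}
-- for a unique divisor e of N (of order N/e); subgroups are represented
-- by such divisors.  ⟨e⟩ ≤ ⟨e'⟩ iff e' ∣ e; ⟨N⟩ = {0}, ⟨1⟩ = Z_N.
-- For e ∣ N the quotient Z_N/⟨e⟩ is identified with Z_e via x ↦ x mod e.

-- total "mod" (x mod 0 = x; only used with nonzero moduli)
_%'_ : ℕ → ℕ → ℕ
a %' zero  = a
a %' suc d = a % suc d

addZ : ℕ → ℕ → ℕ → ℕ
addZ N a b = (a + b) %' N

subZ : ℕ → ℕ → ℕ → ℕ
subZ N a b = (a + (N ∸ b)) %' N

negZ : ℕ → ℕ → ℕ
negZ N a = (N ∸ a) %' N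

count : ℕ → (ℕ → Bool) → ℕ
count zero    f = 0
count (suc k) f = count k f + (if f k then 1 else 0)

anyB : ℕ → (ℕ → Bool) → Bool
anyB zero    f = false
anyB (suc k) f = anyB k f ∨ f k

quot : (N e : ℕ) → (ℕ → Bool) → (ℕ → Bool)
quot N e X j = anyB N (λ i → X i ∧ (i %' e ≡ᵇ j))

IsConnectionSet : ℕ → (ℕ → Bool) → Set
IsConnectionSet n S = (S 0 ≡ false) × (∀ a → a < n → S a ≡ S (negZ n a))

S₀ : (ℕ → Bool) → (ℕ → Bool)
S₀ S i = S i ∨ (i ≡ᵇ 0)

data Reach (n : ℕ) (S : ℕ → Bool) : ℕ → Set where
  base : Reach n S 0
  step : ∀ {a s} → Reach n S a → s < n → S s ≡ true → Reach n S (addZ n a s)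

-- Cay(Z_n,S) is connected (S = -S, so reachability from 0 suffices)
Connected : ℕ → (ℕ → Bool) → Set
Connected n S = ∀ v → v < n → Reach n S v

-- D is a perfect code: every vertex v is at distance ≤ 1 (v - c ∈ S₀)
-- from exactly one c ∈ D
IsPerfectCode : ℕ → (ℕ → Bool) → (ℕ → Bool) → Set
IsPerfectCode n S D =
  (v : Fin n) → count n (λ c → D c ∧ S₀ S (subZ n (toℕ v) c)) ≡ 1

isPerfectCode? : ∀ n S D → Dec (IsPerfectCode n S D)
isPerfectCode? n S D = all? (λ v → count n (λ c → D c ∧ S₀ S (subZ n (toℕ v) c)) ≟ 1)

-- all subsets of Z_N, as bit lists of length N (pairwise distinct)
bitLists : ℕ → List (List Bool)
bitLists zero    = [] ∷ []
bitLists (suc k) = map (true ∷_) (bitLists k) ++ map (false ∷_) (bitLists k)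

toSet : List Bool → ℕ → Bool
toSet []       _       = false
toSet (b ∷ bs) zero    = b
toSet (b ∷ bs) (suc i) = toSet bs i

PerfectCodeWith0 : ℕ → (ℕ → Bool) → List Bool → Set
PerfectCodeWith0 n S bs = IsPerfectCode n S (toSet bs) × (toSet bs 0 ≡ true)

c : ℕ → (ℕ → Bool) → ℕ
c n S = length (filter (λ bs → isPerfectCode? n S (toSet bs) ×-dec (toSet bs 0 ≟ᵇ true))
                       (bitLists n))

IsTransInv : ℕ → (ℕ → Bool) → ℕ → Set
IsTransInv N X a = ∀ x → x < N → X x ≡ X (addZ N x a)

Aperiodic : ℕ → (ℕ → Bool) → Set
Aperiodic N X = ∀ a → a < N → IsTransInv N X a → a ≡ 0

PeriodsAre : ℕ → (ℕ → Bool) → ℕ → Set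
PeriodsAre N X e = ∀ a → a < N → (IsTransInv N X a → e ∣ a) × (e ∣ a → IsTransInv N X a)

-- Pyramidal sets.  A series H_0 < … < H_{2t-1} ≤ H_{2t} is given by
-- divisors d 0, …, d (2t) with H_j = ⟨d j⟩.

-- Conditions (T1)–(T3) for Y ⊆ Z_N and the series ⟨d j⟩ of Z_N
-- (d 0 = N, i.e. the series starts at the trivial subgroup).
T123 : (N : ℕ) → (ℕ → Bool) → (t : ℕ) → (ℕ → ℕ) → Set
T123 N Y t d =
  -- (T1) (Y/H_{2i} - Y/H_{2i}) ∩ (H_{2i+1}/H_{2i}) = {0}, 0 ≤ i ≤ t-1
  (∀ i → i < t → ∀ x y → x < d (2 * i) → y < d (2 * i) →
      Q (2 * i) x ≡ true → Q (2 * i) y ≡ true →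
      d (1 + 2 * i) ∣ subZ (d (2 * i)) x y → subZ (d (2 * i)) x y ≡ 0)
  -- (T2) Y/H_{2i-1} is (H_{2i}/H_{2i-1})-periodic, 1 ≤ i ≤ t
  × (∀ i → i < t → PeriodsAre (d (1 + 2 * i)) (Q (1 + 2 * i)) (d (2 + 2 * i)))
  × (count (d (2 * t ∸ 1)) (Q (2 * t ∸ 1)) ≡ d (2 * t ∸ 1))
  × (∀ i → i < t → count (d (2 * i)) (Q (2 * i)) ≡ count (d (1 + 2 * i)) (Q (1 + 2 * i)))
  where
  Q : ℕ → ℕ → Bool
  Q j = quot N (d j) Y

record Admissible (n : ℕ) (X : ℕ → Bool) (t : ℕ) (d : ℕ → ℕ) : Set where
  field
    t≥1    : 1 ≤ t
    d0∣n   : d 0 ∣ n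
    chain  : ∀ j → j < 2 * t → d (suc j) ∣ d j
    strict : ∀ j → suc j < 2 * t → d (suc j) ≢ d j
    top    : d (2 * t) ≡ 1
    cases  : (d 0 ≡ n × Aperiodic n X × T123 n X t d)
           ⊎ (d 0 ≢ n × PeriodsAre n X (d 0) × T123 (d 0) (quot n (d 0) X) t d)

Pyramidal : ℕ → (ℕ → Bool) → Set
Pyramidal n X = (X 0 ≡ true) × ∃ λ t → ∃ λ d → Admissible n X t d

LongestAdmissible : ℕ → (ℕ → Bool) → ℕ → (ℕ → ℕ) → Set
LongestAdmissible n X t d =
  Admissible n X t d × (∀ t' d' → Admissible n X t' d' → t' ≤ t)

-- associated sequences h(S₀), k(S₀) for the series d (H_j = ⟨d j⟩):
-- k_0 = m, H_0 = ⟨p^{h_0} m⟩, k_{i} = k_{i-1} / |H_{2i-1}/H_{2i-2}|,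
-- h_i = h_{i-1} - log_p |H_{2i}/H_{2i-1}|  (|H_{j+1}/H_j| = d j / d (j+1)),
-- written multiplicatively (these relations determine h, k uniquely).
AssocSeqs : (p m t : ℕ) → (d : ℕ → ℕ) → (h k : ℕ → ℕ) → Set
AssocSeqs p m t d h k =
  (k 0 ≡ m) × (d 0 ≡ p ^ h 0 * m)
  × (∀ j → j < t → (k j * d (1 + 2 * j) ≡ k (suc j) * d (2 * j))
                 × (p ^ h j * d (2 + 2 * j) ≡ p ^ h (suc j) * d (1 + 2 * j)))

sumBelow : ℕ → (ℕ → ℕ) → ℕ
sumBelow zero    f = 0
sumBelow (suc t) f = sumBelow t f + f t

-- h_{i-1} with the convention h_{-1} = ℓ
hPrev : ℕ → (ℕ → ℕ) → ℕ → ℕ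
hPrev ℓ h zero    = ℓ
hPrev ℓ h (suc i) = h i

-- (Σ_{i=0}^{t-1} (h_{i-1} - h_i) k_i) + h_{t-1} - ℓ   (this is ≥ 0)
exponent : (ℓ t : ℕ) → (h k : ℕ → ℕ) → ℕ
exponent ℓ t h k = (sumBelow t (λ i → (hPrev ℓ h i ∸ h i) * k i) + h (t ∸ 1)) ∸ ℓ

-- A perfect code of Cay(Z_n, S) containing 0 is a tiling C ⊕ S₀ = Z_n with 0 ∈ C.  Such tilings
-- are built along the admissible series in the quotients Z_n/H_j, starting from {0} in
-- Z_n/H_{2t} = 0.  Across H_{2i+1} ≤ H_{2i+2}, where S₀/H_{2i+1} is (H_{2i+2}/H_{2i+1})-periodic
-- by (T2), a tiling of size k lifts to a tiling for every choice of coset representatives of its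
-- nonzero elements: a step of index p^a yields p^(a(k − 1)) distinct lifts.  Across
-- H_{2i} ≤ H_{2i+1}, condition (T1) makes reduction modulo H_{2i+1} injective on S₀/H_{2i}, so
-- the preimage of a tiling is a tiling.  A final lift across H_0 reaches Z_n.  This produces
-- p^(Σ_{i ≤ t} (h_{i−1} − h_i)(k_i − 1)) perfect codes, and that exponent is the stated one
-- because Σ_{i<t} (h_{i−1} − h_i) = ℓ − h_{t−1} and k_t = 1.

{-# OPTIONS --safe #-}
module Submission where

open import Defs
import Algebra.Properties.CommutativeSemigroup as CommSemigroupProperties
open import Data.Bool using (Bool; true; false; _∧_; not; if_then_else_)
open import Data.Bool.Properties using (T-≡; ∧-zeroʳ; ∧-identityʳ; ∨-zeroʳ) renaming (_≟_ to _≟ᵇ_)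
open import Data.Fin using (toℕ)
open import Data.Fin.Properties using (toℕ<n)
open import Data.Empty using (⊥-elim)
open import Data.Nat using (ℕ; zero; suc; _+_; _*_; _∸_; _^_; _≤_; _<_; _≡ᵇ_; _<ᵇ_;
  NonZero; z≤n; s≤s; z<s; s≤s⁻¹; s<s⁻¹; ≢-nonZero; ≢-nonZero⁻¹; >-nonZero; >-nonZero⁻¹;
  nonTrivial⇒n>1)
open import Data.Nat.Properties
open import Data.Nat.DivMod
open import Data.Nat.Primality using (Prime; prime⇒nonTrivial)
open import Data.Nat.Divisibility using (_∣_; divides; ∣-refl; ∣-trans; ∣⇒≤; >⇒∤; 0∣⇒≡0; m%n≡0⇒n∣m; n∣m*n)
open import Data.List using (List; []; _∷_; [_]; map; concatMap; applyUpTo; length; filter)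
open import Data.List.Properties using (length-++; length-map; length-applyUpTo; length-removeAt′)
open import Data.List.Membership.Propositional using (_∈_)
open import Data.List.Membership.Propositional.Properties using (∈-map⁺; ∈-++⁺ˡ; ∈-++⁺ʳ; ∈-filter⁺)
open import Data.List.Relation.Unary.Any using (here; there; _─_)
open import Data.List.Relation.Unary.Unique.Propositional using (Unique)
open import Data.List.Relation.Unary.All as All using (All; []; _∷_)
import Data.List.Relation.Unary.All.Properties as All
open import Data.List.Relation.Unary.AllPairs as AllPairs using (AllPairs; []; _∷_)
import Data.List.Relation.Unary.AllPairs.Properties as AllPairs
open import Data.Product using (Σ; ∃; _×_; _,_; proj₁; proj₂)
open import Data.Sum using (_⊎_; inj₁; inj₂; [_,_]′)
open import Function using (_∘_; Equivalence)
open import Relation.Binary.PropositionalEquality hiding ([_])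
open import Relation.Nullary using (yes; no; _×-dec_)

private
  module +-CS = CommSemigroupProperties +-commutativeSemigroup
  module *-CS = CommSemigroupProperties *-commutativeSemigroup

≡ᵇ-refl : ∀ n → (n ≡ᵇ n) ≡ true
≡ᵇ-refl n = Equivalence.to T-≡ (≡⇒≡ᵇ n n refl)

≡ᵇ-true⇒≡ : ∀ {m n} → (m ≡ᵇ n) ≡ true → m ≡ n
≡ᵇ-true⇒≡ {m} {n} eq = ≡ᵇ⇒≡ m n (Equivalence.from T-≡ eq)

≢⇒≡ᵇ-false : ∀ {m n} → m ≢ n → (m ≡ᵇ n) ≡ false
≢⇒≡ᵇ-false {m} {n} m≢n with m ≡ᵇ n in eq
... | false = refl
... | true  = ⊥-elim (m≢n (≡ᵇ-true⇒≡ eq))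

∧-true⁻ : ∀ {a b} → a ∧ b ≡ true → a ≡ true × b ≡ true
∧-true⁻ {true} {true} refl = refl , refl

bit : Bool → ℕ
bit b = if b then 1 else 0

count-cong : ∀ N {f g : ℕ → Bool} → (∀ i → i < N → f i ≡ g i) → count N f ≡ count N g
count-cong zero    f≐g = refl
count-cong (suc N) f≐g =
  cong₂ (λ a b → a + bit b) (count-cong N (λ i i<N → f≐g i (m<n⇒m<1+n i<N))) (f≐g N ≤-refl)

count-+ : ∀ a b f → count (a + b) f ≡ count a f + count b (λ x → f (a + x))
count-+ a zero    f = trans (cong (λ n → count n f) (+-identityʳ a)) (sym (+-identityʳ _))
count-+ a (suc b) f rewrite +-suc a b | count-+ a b f = +-assoc (count a f) _ _

count-add : ∀ N (f g h : ℕ → Bool) → (∀ i → i < N → bit (h i) ≡ bit (f i) + bit (g i)) →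
  count N h ≡ count N f + count N g
count-add zero    f g h pointwise = refl
count-add (suc N) f g h pointwise = begin
  count N h + bit (h N)
    ≡⟨ cong₂ _+_ (count-add N f g h (λ i i<N → pointwise i (m<n⇒m<1+n i<N))) (pointwise N ≤-refl) ⟩
  (count N f + count N g) + (bit (f N) + bit (g N))
    ≡⟨ +-CS.interchange (count N f) _ _ _ ⟩
  (count N f + bit (f N)) + (count N g + bit (g N))
    ∎
  where open ≡-Reasoning

count-none : ∀ N (f : ℕ → Bool) → (∀ i → i < N → f i ≡ false) → count N f ≡ 0
count-none zero    f none = refl
count-none (suc N) f none rewrite none N ≤-refl =
  trans (+-identityʳ _) (count-none N f (λ i i<N → none i (m<n⇒m<1+n i<N)))

count-one : ∀ N (f : ℕ → Bool) x → x < N → f x ≡ true → (∀ y → y < N → f y ≡ true → y ≡ x) → count N f ≡ 1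
count-one (suc N) f x x<1+N fx only with x ≟ N
... | yes refl rewrite fx = cong (_+ 1) (count-none N f λ y y<N → outside y y<N)
  where
  outside : ∀ y → y < N → f y ≡ false
  outside y y<N with f y in fy
  ... | false = refl
  ... | true  = ⊥-elim (<-irrefl (only y (m<n⇒m<1+n y<N) fy) y<N)
... | no x≢N with f N in fN
...   | true  = ⊥-elim (x≢N (sym (only N ≤-refl fN)))
...   | false = trans (+-identityʳ _)
                  (count-one N f x (≤∧≢⇒< (s≤s⁻¹ x<1+N) x≢N) fx (λ y y<N → only y (m<n⇒m<1+n y<N)))

-- Arithmetic in Z_N

%'≡% : ∀ a N .{{_ : NonZero N}} → a %' N ≡ a % N
%'≡% a (suc N) = refl

%-cong-+ʳ : ∀ {a a'} b N .{{_ : NonZero N}} → a % N ≡ a' % N → (a + b) % N ≡ (a' + b) % N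
%-cong-+ʳ {a} {a'} b N eq = begin
  (a + b) % N              ≡⟨ %-distribˡ-+ a b N ⟩
  (a % N + b % N) % N      ≡⟨ cong (λ w → (w + b % N) % N) eq ⟩
  (a' % N + b % N) % N     ≡⟨ %-distribˡ-+ a' b N ⟨
  (a' + b) % N             ∎
  where open ≡-Reasoning

subZ<N : ∀ N a b .{{_ : NonZero N}} → subZ N a b < N
subZ<N N a b = subst (_< N) (sym (%'≡% (a + (N ∸ b)) N)) (m%n<n _ N)

subZ-+ : ∀ N a b .{{_ : NonZero N}} → b ≤ N → (subZ N a b + b) % N ≡ a % N
subZ-+ N a b b≤N = begin
  (subZ N a b + b) % N           ≡⟨ cong (λ w → (w + b) % N) (%'≡% (a + (N ∸ b)) N) ⟩
  ((a + (N ∸ b)) % N + b) % N    ≡⟨ %-cong-+ʳ b N (m%n%n≡m%n _ N) ⟩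
  (a + (N ∸ b) + b) % N          ≡⟨ cong (_% N) (trans (+-assoc a _ b) (cong (a +_) (m∸n+n≡m b≤N))) ⟩
  (a + N) % N                    ≡⟨ [m+n]%n≡m%n a N ⟩
  a % N                          ∎
  where open ≡-Reasoning

subZ-unique : ∀ N a b z .{{_ : NonZero N}} → b ≤ N → z < N → (z + b) % N ≡ a % N → subZ N a b ≡ z
subZ-unique N a b z b≤N z<N eq = begin
  subZ N a b                 ≡⟨ %'≡% (a + (N ∸ b)) N ⟩
  (a + (N ∸ b)) % N          ≡⟨ %-cong-+ʳ (N ∸ b) N eq ⟨
  (z + b + (N ∸ b)) % N      ≡⟨ cong (_% N) (trans (+-assoc z b _) (cong (z +_) (m+[n∸m]≡n b≤N))) ⟩
  (z + N) % N                ≡⟨ [m+n]%n≡m%n z N ⟩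
  z % N                      ≡⟨ m<n⇒m%n≡m z<N ⟩
  z                          ∎
  where open ≡-Reasoning

subZ-involutive : ∀ N a b .{{_ : NonZero N}} → b < N → subZ N a (subZ N a b) ≡ b
subZ-involutive N a b b<N = subZ-unique N a _ b (<⇒≤ (subZ<N N a b)) b<N
  (trans (cong (_% N) (+-comm b _)) (subZ-+ N a b (<⇒≤ b<N)))

subZ-self : ∀ N a .{{_ : NonZero N}} → a ≤ N → subZ N a a ≡ 0
subZ-self N a a≤N = subZ-unique N a a 0 a≤N (>-nonZero⁻¹ N) refl

subZ≡0⇒≡ : ∀ N x y .{{_ : NonZero N}} → x < N → y < N → subZ N x y ≡ 0 → x ≡ y
subZ≡0⇒≡ N x y x<N y<N x-y≡0 = begin
  x                      ≡⟨ m<n⇒m%n≡m x<N ⟨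
  x % N                  ≡⟨ subZ-+ N x y (<⇒≤ y<N) ⟨
  (subZ N x y + y) % N   ≡⟨ cong (λ w → (w + y) % N) x-y≡0 ⟩
  y % N                  ≡⟨ m<n⇒m%n≡m y<N ⟩
  y                      ∎
  where open ≡-Reasoning

subZ-% : ∀ N e a b .{{_ : NonZero N}} .{{_ : NonZero e}} → e ∣ N → b ≤ N →
  subZ N a b % e ≡ subZ e (a % e) (b % e)
subZ-% N e a b e∣N b≤N = sym (subZ-unique e (a % e) (b % e) _ (m%n≤n b e) (m%n<n _ e) (begin
  (subZ N a b % e + b % e) % e    ≡⟨ %-distribˡ-+ (subZ N a b) b e ⟨
  (subZ N a b + b) % e            ≡⟨ m∣n⇒o%n%m≡o%m e N _ e∣N ⟨
  (subZ N a b + b) % N % e        ≡⟨ cong (_% e) (subZ-+ N a b b≤N) ⟩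
  a % N % e                       ≡⟨ m∣n⇒o%n%m≡o%m e N a e∣N ⟩
  a % e                           ≡⟨ m%n%n≡m%n a e ⟨
  a % e % e                       ∎))
  where open ≡-Reasoning

≡-mod⇒∣subZ : ∀ N e x y .{{_ : NonZero N}} .{{_ : NonZero e}} → e ∣ N → y ≤ N →
  x % e ≡ y % e → e ∣ subZ N x y
≡-mod⇒∣subZ N e x y e∣N y≤N x≡y = m%n≡0⇒n∣m _ e (begin
  subZ N x y % e               ≡⟨ subZ-% N e x y e∣N y≤N ⟩
  subZ e (x % e) (y % e)       ≡⟨ cong (λ w → subZ e w (y % e)) x≡y ⟩
  subZ e (y % e) (y % e)       ≡⟨ subZ-self e (y % e) (m%n≤n y e) ⟩
  0                            ∎)
  where open ≡-Reasoning

m<n⇒[m+kn]%n≡m : ∀ {m n} k .{{_ : NonZero n}} → m < n → (m + k * n) % n ≡ m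
m<n⇒[m+kn]%n≡m {m} {n} k m<n = trans ([m+kn]%n≡m%n m k n) (m<n⇒m%n≡m m<n)

m<n⇒[m+kn]/n≡k : ∀ {m n} k .{{_ : NonZero n}} → m < n → (m + k * n) / n ≡ k
m<n⇒[m+kn]/n≡k {m} {n} k m<n =
  trans (+-distrib-/-∣ʳ m (n∣m*n k)) (cong₂ _+_ (m<n⇒m/n≡0 m<n) (m*n/n≡m k n))

m<n⇒m+kn<qn : ∀ {m n k q} → m < n → k < q → m + k * n < q * n
m<n⇒m+kn<qn {m} {n} {k} {q} m<n k<q = begin-strict
  m + k * n    <⟨ +-monoˡ-< (k * n) m<n ⟩
  suc k * n    ≤⟨ *-monoˡ-≤ n k<q ⟩
  q * n        ∎
  where open ≤-Reasoning

anyB-true⁻ : ∀ N f → anyB N f ≡ true → ∃ λ i → i < N × f i ≡ true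
anyB-true⁻ (suc N) f any with anyB N f in anyBelow
... | true  = let i , i<N , fi = anyB-true⁻ N f anyBelow in i , m<n⇒m<1+n i<N , fi
... | false = N , ≤-refl , any

anyB-true⁺ : ∀ N f i → i < N → f i ≡ true → anyB N f ≡ true
anyB-true⁺ (suc N) f i i<1+N fi with i ≟ N
... | yes refl rewrite fi = ∨-zeroʳ (anyB N f)
... | no i≢N rewrite anyB-true⁺ N f i (≤∧≢⇒< (s≤s⁻¹ i<1+N) i≢N) fi = refl

record IsQuotient (N e : ℕ) .{{_ : NonZero e}} (Y Y' : ℕ → Bool) : Set where
  field
    image    : ∀ i → i < N → Y i ≡ true → Y' (i % e) ≡ true
    preimage : ∀ j → j < e → Y' j ≡ true → ∃ λ i → i < N × Y i ≡ true × i % e ≡ j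

open IsQuotient

quot-isQuotient : ∀ N e Y .{{_ : NonZero e}} → IsQuotient N e Y (quot N e Y)
quot-isQuotient N e Y .image i i<N Yi = anyB-true⁺ N _ i i<N
  (cong₂ _∧_ Yi (trans (cong (_≡ᵇ i % e) (%'≡% i e)) (≡ᵇ-refl (i % e))))
quot-isQuotient N e Y .preimage j j<e Y'j =
  let i , i<N , hit = anyB-true⁻ N _ Y'j
      Yi , i%e≡j = ∧-true⁻ {Y i} hit
  in i , i<N , Yi , trans (sym (%'≡% i e)) (≡ᵇ-true⇒≡ i%e≡j)

isQuotient-trans : ∀ {N D e Y Y' Y''} .{{_ : NonZero D}} .{{_ : NonZero e}} → e ∣ D →
  IsQuotient N D Y Y' → IsQuotient D e Y' Y'' → IsQuotient N e Y Y''
isQuotient-trans {N} {D} {e} {Y'' = Y''} e∣D Y↠Y' Y'↠Y'' .image i i<N Yi =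
  subst (λ w → Y'' w ≡ true) (m∣n⇒o%n%m≡o%m e D i e∣D) (image Y'↠Y'' _ (m%n<n i D) (image Y↠Y' i i<N Yi))
isQuotient-trans {N} {D} {e} e∣D Y↠Y' Y'↠Y'' .preimage j j<e Y''j =
  let i' , i'<D , Y'i' , i'%e≡j = preimage Y'↠Y'' j j<e Y''j
      i , i<N , Yi , i%D≡i' = preimage Y↠Y' i' i'<D Y'i'
  in i , i<N , Yi , trans (sym (m∣n⇒o%n%m≡o%m e D i e∣D)) (trans (cong (_% e) i%D≡i') i'%e≡j)

isQuotient-factor : ∀ {N D e Y Y' Y''} .{{_ : NonZero D}} .{{_ : NonZero e}} → e ∣ D →
  IsQuotient N D Y Y' → IsQuotient N e Y Y'' → IsQuotient D e Y' Y''
isQuotient-factor {N} {D} {e} {Y'' = Y''} e∣D Y↠Y' Y↠Y'' .image i i<D Y'i =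
  let i₀ , i₀<N , Yi₀ , i₀%D≡i = preimage Y↠Y' i i<D Y'i
  in subst (λ w → Y'' w ≡ true) (trans (sym (m∣n⇒o%n%m≡o%m e D i₀ e∣D)) (cong (_% e) i₀%D≡i))
       (image Y↠Y'' i₀ i₀<N Yi₀)
isQuotient-factor {N} {D} {e} e∣D Y↠Y' Y↠Y'' .preimage j j<e Y''j =
  let i₀ , i₀<N , Yi₀ , i₀%e≡j = preimage Y↠Y'' j j<e Y''j
  in i₀ % D , m%n<n i₀ D , image Y↠Y' i₀ i₀<N Yi₀ , trans (m∣n⇒o%n%m≡o%m e D i₀ e∣D) i₀%e≡j

isQuotient-0 : ∀ {N e Y Y'} .{{_ : NonZero N}} .{{_ : NonZero e}} →
  IsQuotient N e Y Y' → Y 0 ≡ true → Y' 0 ≡ true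
isQuotient-0 {N} {e} {Y' = Y'} Y↠Y' Y0 =
  subst (λ w → Y' w ≡ true) (m<n⇒m%n≡m (>-nonZero⁻¹ e)) (image Y↠Y' 0 (>-nonZero⁻¹ N) Y0)

isQuotient-subZ : ∀ {N e Y Y'} v z .{{_ : NonZero N}} .{{_ : NonZero e}} → e ∣ N →
  IsQuotient N e Y Y' → z ≤ N → Y (subZ N v z) ≡ true → Y' (subZ e (v % e) (z % e)) ≡ true
isQuotient-subZ {N} {e} {Y' = Y'} v z e∣N Y↠Y' z≤N Yv-z =
  subst (λ w → Y' w ≡ true) (subZ-% N e v z e∣N z≤N) (image Y↠Y' _ (subZ<N N v z) Yv-z)

-- Tilings and their lifts to extensions

-- C ⊕ Y = Z_N.  When 0 ∈ Y this says that C is a perfect code of Cay(Z_N, Y ∖ {0}).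
Tiling : ℕ → (ℕ → Bool) → (ℕ → Bool) → Set
Tiling N Y C = ∀ v → v < N → Σ ℕ λ x → x < N × C x ≡ true × Y (subZ N v x) ≡ true ×
  (∀ x' → x' < N → C x' ≡ true → Y (subZ N v x') ≡ true → x' ≡ x)

ModInjective : ℕ → ℕ → (ℕ → Bool) → Set
ModInjective N e Y = ∀ x y → x < N → y < N → Y x ≡ true → Y y ≡ true →
  e ∣ subZ N x y → subZ N x y ≡ 0

PeriodicBy : ℕ → ℕ → (ℕ → Bool) → Set
PeriodicBy N e Y = ∀ a → a < N → e ∣ a → IsTransInv N Y a

periodicBy-self : ∀ N Y .{{_ : NonZero N}} → PeriodicBy N N Y
periodicBy-self N Y zero    _   _   x x<N =
  cong Y (sym (trans (%'≡% (x + 0) N) (trans (cong (_% N) (+-identityʳ x)) (m<n⇒m%n≡m x<N))))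
periodicBy-self N Y (suc a) a<N N∣a = ⊥-elim (>⇒∤ a<N N∣a)

periodicBy-≡mod : ∀ N e {Y} y z .{{_ : NonZero N}} .{{_ : NonZero e}} → e ∣ N → PeriodicBy N e Y →
  y < N → z < N → z % e ≡ y % e → Y y ≡ Y z
periodicBy-≡mod N e {Y} y z e∣N periodic y<N z<N z≡y = begin
  Y y                            ≡⟨ periodic _ (subZ<N N z y) (≡-mod⇒∣subZ N e z y e∣N (<⇒≤ y<N) z≡y) y y<N ⟩
  Y ((y + subZ N z y) %' N)      ≡⟨ cong Y (%'≡% _ N) ⟩
  Y ((y + subZ N z y) % N)       ≡⟨ cong (λ w → Y (w % N)) (+-comm y _) ⟩
  Y ((subZ N z y + y) % N)       ≡⟨ cong Y (subZ-+ N z y (<⇒≤ y<N)) ⟩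
  Y (z % N)                      ≡⟨ cong Y (m<n⇒m%n≡m z<N) ⟩
  Y z                            ∎
  where open ≡-Reasoning

pullback : (e : ℕ) .{{_ : NonZero e}} → (ℕ → Bool) → ℕ → Bool
pullback e C x = C (x % e)

-- {r + f r · e : r ∈ C}: C ⊆ Z_e lifted to Z_N along the coset representatives chosen by f
lift : (e : ℕ) .{{_ : NonZero e}} → (ℕ → Bool) → (ℕ → ℕ) → ℕ → Bool
lift e C f x = C (x % e) ∧ (f (x % e) ≡ᵇ x / e)

lift-at : ∀ e C f {r} j .{{_ : NonZero e}} → r < e → lift e C f (r + j * e) ≡ C r ∧ (f r ≡ᵇ j)
lift-at e C f j r<e =
  cong₂ (λ r' j' → C r' ∧ (f r' ≡ᵇ j')) (m<n⇒[m+kn]%n≡m j r<e) (m<n⇒[m+kn]/n≡k j r<e)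

-- The centre of v is v − y for the y ∈ Y lying over (v mod e) − x₀, x₀ the centre of v mod e;
-- two such y differ by an element of ⟨e⟩, so (T1) makes y unique.
pullback-tiling : ∀ N e {Y Y' C} .{{_ : NonZero N}} .{{_ : NonZero e}} → e ∣ N →
  IsQuotient N e Y Y' → ModInjective N e Y → Tiling e Y' C → Tiling N Y (pullback e C)
pullback-tiling N e {Y} {Y'} {C} e∣N Y↠Y' injective tiling v v<N
  with tiling (v % e) (m%n<n v e)
... | x₀ , x₀<e , Cx₀ , Y'v-x₀ , unique₀ with preimage Y↠Y' _ (subZ<N e (v % e) x₀) Y'v-x₀
... | y , y<N , Yy , y%e = subZ N v y , subZ<N N v y , C[v-y] , Y[v-[v-y]] , unique
  where
  open ≡-Reasoning
  C[v-y] : C (subZ N v y % e) ≡ true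
  C[v-y] = subst (λ w → C w ≡ true) (sym (begin
    subZ N v y % e                        ≡⟨ subZ-% N e v y e∣N (<⇒≤ y<N) ⟩
    subZ e (v % e) (y % e)                ≡⟨ cong (subZ e (v % e)) y%e ⟩
    subZ e (v % e) (subZ e (v % e) x₀)    ≡⟨ subZ-involutive e (v % e) x₀ x₀<e ⟩
    x₀                                    ∎)) Cx₀
  Y[v-[v-y]] : Y (subZ N v (subZ N v y)) ≡ true
  Y[v-[v-y]] = subst (λ w → Y w ≡ true) (sym (subZ-involutive N v y y<N)) Yy
  unique : ∀ x' → x' < N → C (x' % e) ≡ true → Y (subZ N v x') ≡ true → x' ≡ subZ N v y
  unique x' x'<N Cx' Yv-x' = begin
    x'                         ≡⟨ subZ-involutive N v x' x'<N ⟨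
    subZ N v (subZ N v x')     ≡⟨ cong (subZ N v) v-x'≡y ⟩
    subZ N v y                 ∎
    where
    x'%e≡x₀ : x' % e ≡ x₀
    x'%e≡x₀ = unique₀ (x' % e) (m%n<n x' e) Cx' (isQuotient-subZ v x' e∣N Y↠Y' (<⇒≤ x'<N) Yv-x')
    v-x'≡y : subZ N v x' ≡ y
    v-x'≡y = subZ≡0⇒≡ N _ y (subZ<N N v x') y<N (injective _ y (subZ<N N v x') y<N Yv-x' Yy
      (≡-mod⇒∣subZ N e _ y e∣N (<⇒≤ y<N) (begin
        subZ N v x' % e           ≡⟨ subZ-% N e v x' e∣N (<⇒≤ x'<N) ⟩
        subZ e (v % e) (x' % e)   ≡⟨ cong (subZ e (v % e)) x'%e≡x₀ ⟩
        subZ e (v % e) x₀         ≡⟨ y%e ⟨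
        y % e                     ∎)))

-- For the lift x of the centre of v mod e, v − x ≡ y (mod e) with y ∈ Y, and ⟨e⟩-periodicity
-- carries y to v − x.
lift-tiling : ∀ N e q {Y Y' C f} .{{_ : NonZero N}} .{{_ : NonZero e}} → N ≡ q * e →
  IsQuotient N e Y Y' → PeriodicBy N e Y → (∀ r → f r < q) → Tiling e Y' C → Tiling N Y (lift e C f)
lift-tiling N e q {Y} {Y'} {C} {f} N≡qe Y↠Y' periodic f<q tiling v v<N
  with tiling (v % e) (m%n<n v e)
... | x₀ , x₀<e , Cx₀ , Y'v-x₀ , unique₀ with preimage Y↠Y' _ (subZ<N e (v % e) x₀) Y'v-x₀
... | y , y<N , Yy , y%e = x , x<N , lift-x , Y[v-x] , unique
  where
  open ≡-Reasoning
  e∣N : e ∣ N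
  e∣N = divides q N≡qe
  x : ℕ
  x = x₀ + f x₀ * e
  x<N : x < N
  x<N = subst (x <_) (sym N≡qe) (m<n⇒m+kn<qn x₀<e (f<q x₀))
  lift-x : lift e C f x ≡ true
  lift-x = trans (lift-at e C f (f x₀) x₀<e) (cong₂ _∧_ Cx₀ (≡ᵇ-refl (f x₀)))
  Y[v-x] : Y (subZ N v x) ≡ true
  Y[v-x] = trans (sym (periodicBy-≡mod N e y (subZ N v x) e∣N periodic y<N (subZ<N N v x) (begin
    subZ N v x % e           ≡⟨ subZ-% N e v x e∣N (<⇒≤ x<N) ⟩
    subZ e (v % e) (x % e)   ≡⟨ cong (subZ e (v % e)) (m<n⇒[m+kn]%n≡m (f x₀) x₀<e) ⟩
    subZ e (v % e) x₀        ≡⟨ y%e ⟨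
    y % e                    ∎))) Yy
  unique : ∀ x' → x' < N → lift e C f x' ≡ true → Y (subZ N v x') ≡ true → x' ≡ x
  unique x' x'<N lift-x' Yv-x' = begin
    x'                               ≡⟨ m≡m%n+[m/n]*n x' e ⟩
    x' % e + (x' / e) * e            ≡⟨ cong (λ j → x' % e + j * e) (≡ᵇ-true⇒≡ {f (x' % e)} on-lift) ⟨
    x' % e + f (x' % e) * e          ≡⟨ cong (λ r → r + f r * e) x'%e≡x₀ ⟩
    x                                ∎
    where
    in-C : C (x' % e) ≡ true
    in-C = proj₁ (∧-true⁻ {C (x' % e)} lift-x')
    on-lift : (f (x' % e) ≡ᵇ x' / e) ≡ true
    on-lift = proj₂ (∧-true⁻ {C (x' % e)} lift-x')
    x'%e≡x₀ : x' % e ≡ x₀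
    x'%e≡x₀ = unique₀ (x' % e) (m%n<n x' e) in-C (isQuotient-subZ v x' e∣N Y↠Y' (<⇒≤ x'<N) Yv-x')

count-pullback : ∀ r e C .{{_ : NonZero e}} → count (r * e) (pullback e C) ≡ r * count e C
count-pullback zero    e C = refl
count-pullback (suc r) e C = begin
  count (e + r * e) (pullback e C)
    ≡⟨ count-+ e (r * e) (pullback e C) ⟩
  count e (pullback e C) + count (r * e) (λ x → C ((e + x) % e))
    ≡⟨ cong₂ _+_ (count-cong e (λ i i<e → cong C (m<n⇒m%n≡m i<e)))
                 (count-cong (r * e) (λ i _ → cong C (%-remove-+ˡ i ∣-refl))) ⟩
  count e C + count (r * e) (pullback e C)
    ≡⟨ cong (count e C +_) (count-pullback r e C) ⟩
  count e C + r * count e C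
    ∎
  where open ≡-Reasoning

bit-<ᵇ-suc : ∀ j q → bit (j <ᵇ suc q) ≡ bit (j <ᵇ q) + bit (j ≡ᵇ q)
bit-<ᵇ-suc zero    zero    = refl
bit-<ᵇ-suc zero    (suc q) = refl
bit-<ᵇ-suc (suc j) zero    = refl
bit-<ᵇ-suc (suc j) (suc q) = bit-<ᵇ-suc j q

count-lift-<ᵇ : ∀ q e C f .{{_ : NonZero e}} → count (q * e) (lift e C f) ≡ count e (λ r → C r ∧ (f r <ᵇ q))
count-lift-<ᵇ zero    e C f = sym (count-none e _ (λ r _ → ∧-zeroʳ (C r)))
count-lift-<ᵇ (suc q) e C f = begin
  count (e + q * e) (lift e C f)
    ≡⟨ cong (λ n → count n (lift e C f)) (+-comm e (q * e)) ⟩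
  count (q * e + e) (lift e C f)
    ≡⟨ count-+ (q * e) e (lift e C f) ⟩
  count (q * e) (lift e C f) + count e (λ r → lift e C f (q * e + r))
    ≡⟨ cong₂ _+_ (count-lift-<ᵇ q e C f)
                 (count-cong e (λ r r<e → trans (cong (lift e C f) (+-comm (q * e) r)) (lift-at e C f q r<e))) ⟩
  count e (λ r → C r ∧ (f r <ᵇ q)) + count e (λ r → C r ∧ (f r ≡ᵇ q))
    ≡⟨ count-add e _ _ _ (λ r _ → split (C r) (f r)) ⟨
  count e (λ r → C r ∧ (f r <ᵇ suc q))
    ∎
  where
  open ≡-Reasoning
  split : ∀ b j → bit (b ∧ (j <ᵇ suc q)) ≡ bit (b ∧ (j <ᵇ q)) + bit (b ∧ (j ≡ᵇ q))
  split false j = refl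
  split true  j = bit-<ᵇ-suc j q

count-lift : ∀ q e C f .{{_ : NonZero e}} → (∀ r → f r < q) → count (q * e) (lift e C f) ≡ count e C
count-lift q e C f f<q = trans (count-lift-<ᵇ q e C f) (count-cong e λ r _ →
  trans (cong (C r ∧_) (Equivalence.to T-≡ (<⇒<ᵇ (f<q r)))) (∧-identityʳ (C r)))

remove0 : (ℕ → Bool) → ℕ → Bool
remove0 C r = C r ∧ not (r ≡ᵇ 0)

count-remove0 : ∀ e C → 0 < e → C 0 ≡ true → count e (remove0 C) ≡ count e C ∸ 1
count-remove0 e C 0<e C0 = begin
  count e (remove0 C)
    ≡⟨ m+n∸n≡m _ 1 ⟨
  count e (remove0 C) + 1 ∸ 1
    ≡⟨ cong (λ n → count e (remove0 C) + n ∸ 1) only0 ⟨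
  count e (remove0 C) + count e (λ r → C r ∧ (r ≡ᵇ 0)) ∸ 1
    ≡⟨ cong (_∸ 1) (count-add e _ _ C (λ r _ → split (C r) (r ≡ᵇ 0))) ⟨
  count e C ∸ 1
    ∎
  where
  open ≡-Reasoning
  only0 : count e (λ r → C r ∧ (r ≡ᵇ 0)) ≡ 1
  only0 = count-one e _ 0 0<e (cong (_∧ true) C0) (λ r _ hit → ≡ᵇ-true⇒≡ (proj₂ (∧-true⁻ {C r} hit)))
  split : ∀ b z → bit b ≡ bit (b ∧ not z) + bit (b ∧ z)
  split false z     = refl
  split true  true  = refl
  split true  false = refl

-- Choices of coset representatives

length-concatMap : ∀ {A B : Set} (g : A → List B) n {xs} → All (λ x → length (g x) ≡ n) xs →
  length (concatMap g xs) ≡ length xs * n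
length-concatMap g n []                       = refl
length-concatMap g n {x ∷ xs} (|gx|≡n ∷ rest) =
  trans (length-++ (g x)) (cong₂ _+_ |gx|≡n (length-concatMap g n rest))

_[_≔_] : (ℕ → ℕ) → ℕ → ℕ → ℕ → ℕ
(f [ k ≔ j ]) r = if r ≡ᵇ k then j else f r

[≔]-updated : ∀ f k j → (f [ k ≔ j ]) k ≡ j
[≔]-updated f k j = cong (if_then j else f k) (≡ᵇ-refl k)

[≔]-unchanged : ∀ f {k} j {r} → r ≢ k → (f [ k ≔ j ]) r ≡ f r
[≔]-unchanged f j {r} r≢k = cong (if_then j else f r) (≢⇒≡ᵇ-false r≢k)

-- all f with f r < q for r ∈ C ∩ [0, k) and f r = 0 elsewhere
choices : ℕ → (ℕ → Bool) → ℕ → List (ℕ → ℕ)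
choices q C zero    = [ (λ _ → 0) ]
choices q C (suc k) =
  if C k then concatMap (λ f → applyUpTo (f [ k ≔_]) q) (choices q C k) else choices q C k

BoundedOn : ℕ → (ℕ → Bool) → (ℕ → ℕ) → Set
BoundedOn q C f = (∀ r → f r < q) × (∀ r → C r ≡ false → f r ≡ 0)

choices-bounded : ∀ q C k → 0 < q → All (BoundedOn q C) (choices q C k)
choices-bounded q C zero    0<q = ((λ _ → 0<q) , (λ _ _ → refl)) ∷ []
choices-bounded q C (suc k) 0<q with C k in Ck
... | false = choices-bounded q C k 0<q
... | true  = All.concat⁺ (All.map⁺ (All.map (λ bounded → All.applyUpTo⁺₁ _ q (update bounded))
                                             (choices-bounded q C k 0<q)))
  where
  update : ∀ {f j} → BoundedOn q C f → j < q → BoundedOn q C (f [ k ≔ j ])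
  update {f} {j} (f<q , f-off) j<q = bound , off
    where
    bound : ∀ r → (f [ k ≔ j ]) r < q
    bound r with r ≡ᵇ k
    ... | true  = j<q
    ... | false = f<q r
    off : ∀ r → C r ≡ false → (f [ k ≔ j ]) r ≡ 0
    off r Cr with r ≟ k
    ... | yes refl with () ← trans (sym Ck) Cr
    ... | no r≢k   = trans ([≔]-unchanged f j r≢k) (f-off r Cr)

DifferOn : ℕ → (ℕ → Bool) → (ℕ → ℕ) → (ℕ → ℕ) → Set
DifferOn k C f g = ∃ λ r → r < k × C r ≡ true × f r ≢ g r

choices-distinct : ∀ q C k → AllPairs (DifferOn k C) (choices q C k)
choices-distinct q C zero    = [] ∷ []
choices-distinct q C (suc k) with C k in Ck
... | false = AllPairs.map (λ (r , r<k , Cr , fr≢gr) → r , m<n⇒m<1+n r<k , Cr , fr≢gr) (choices-distinct q C k)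
... | true  = AllPairs.concat⁺
  (All.map⁺ (All.universal (λ f → AllPairs.applyUpTo⁺₁ _ q (λ i<j _ → at-k f i<j)) _))
  (AllPairs.map⁺ (AllPairs.map (λ differ → All.applyUpTo⁺₂ _ q λ i → All.applyUpTo⁺₂ _ q λ j → below differ)
                               (choices-distinct q C k)))
  where
  at-k : ∀ f {i j} → i < j → DifferOn (suc k) C (f [ k ≔ i ]) (f [ k ≔ j ])
  at-k f {i} {j} i<j = k , ≤-refl , Ck ,
    λ eq → <⇒≢ i<j (trans (sym ([≔]-updated f k i)) (trans eq ([≔]-updated f k j)))
  below : ∀ {f g i j} → DifferOn k C f g → DifferOn (suc k) C (f [ k ≔ i ]) (g [ k ≔ j ])
  below {f} {g} {i} {j} (r , r<k , Cr , fr≢gr) = r , m<n⇒m<1+n r<k , Cr ,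
    λ eq → fr≢gr (trans (sym ([≔]-unchanged f i (<⇒≢ r<k))) (trans eq ([≔]-unchanged g j (<⇒≢ r<k))))

length-choices : ∀ q C k → length (choices q C k) ≡ q ^ count k C
length-choices q C zero    = refl
length-choices q C (suc k) with C k
... | false = trans (length-choices q C k) (cong (q ^_) (sym (+-identityʳ (count k C))))
... | true  = begin
  length (concatMap (λ f → applyUpTo (f [ k ≔_]) q) (choices q C k))
    ≡⟨ length-concatMap (λ f → applyUpTo (f [ k ≔_]) q) q
         (All.universal (λ f → length-applyUpTo (f [ k ≔_]) q) (choices q C k)) ⟩
  length (choices q C k) * q          ≡⟨ cong (_* q) (length-choices q C k) ⟩
  q ^ count k C * q                   ≡⟨ *-comm _ q ⟩
  q ^ suc (count k C)                 ≡⟨ cong (q ^_) (+-comm 1 (count k C)) ⟩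
  q ^ (count k C + 1)                 ∎
  where open ≡-Reasoning

allPairs-with-all : ∀ {A : Set} {P : A → Set} {R : A → A → Set} {xs} → All P xs → AllPairs R xs →
  AllPairs (λ x y → P x × P y × R x y) xs
allPairs-with-all []         []         = []
allPairs-with-all (px ∷ pxs) (rx ∷ rxs) =
  All.zipWith (λ (py , r) → px , py , r) (pxs , rx) ∷ allPairs-with-all pxs rxs

DifferBelow : ℕ → (ℕ → Bool) → (ℕ → Bool) → Set
DifferBelow N A B = ∃ λ x → x < N × A x ≢ B x

differBelow-sym : ∀ {N A B} → DifferBelow N A B → DifferBelow N B A
differBelow-sym (x , x<N , Ax≢Bx) = x , x<N , λ eq → Ax≢Bx (sym eq)

≡true-≡false⇒≢ : ∀ {a b} → a ≡ true → b ≡ false → a ≢ b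
≡true-≡false⇒≢ refl refl ()

lift-differ : ∀ N e q {C C' f g r} .{{_ : NonZero e}} → N ≡ q * e → r < e → f r < q → C r ≡ true →
  C' r ≡ false ⊎ g r ≢ f r → DifferBelow N (lift e C f) (lift e C' g)
lift-differ N e q {C} {C'} {f} {g} {r} N≡qe r<e fr<q Cr C'r-or-gr≢fr =
  r + f r * e , subst (r + f r * e <_) (sym N≡qe) (m<n⇒m+kn<qn r<e fr<q) ,
  ≡true-≡false⇒≢ on-lift (trans (lift-at e C' g (f r) r<e) (off-lift C'r-or-gr≢fr))
  where
  on-lift : lift e C f (r + f r * e) ≡ true
  on-lift = trans (lift-at e C f (f r) r<e) (cong₂ _∧_ Cr (≡ᵇ-refl (f r)))
  off-lift : C' r ≡ false ⊎ g r ≢ f r → C' r ∧ (g r ≡ᵇ f r) ≡ false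
  off-lift (inj₁ C'r)   = cong (_∧ (g r ≡ᵇ f r)) C'r
  off-lift (inj₂ gr≢fr) = trans (cong (C' r ∧_) (≢⇒≡ᵇ-false gr≢fr)) (∧-zeroʳ (C' r))

record TilingFamily (N : ℕ) (Y : ℕ → Bool) (k : ℕ) (L : List (ℕ → Bool)) : Set where
  field
    tiles    : All (Tiling N Y) L
    has0     : All (λ C → C 0 ≡ true) L
    size     : All (λ C → count N C ≡ k) L
    distinct : AllPairs (DifferBelow N) L

open TilingFamily

singleton-family : ∀ {Y} → Y 0 ≡ true → TilingFamily 1 Y 1 [ (_≡ᵇ 0) ]
singleton-family {Y} Y0 = record
  { tiles    = tiling ∷ []
  ; has0     = refl ∷ []
  ; size     = refl ∷ []
  ; distinct = [] ∷ []
  }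
  where
  tiling : Tiling 1 Y (_≡ᵇ 0)
  tiling zero    _         = 0 , z<s , refl , Y0 , λ { zero _ _ _ → refl ; (suc _) (s≤s ()) }
  tiling (suc _) (s≤s ())

pullback-family : ∀ N e r {Y Y' k L} .{{_ : NonZero N}} .{{_ : NonZero e}} → N ≡ r * e →
  IsQuotient N e Y Y' → ModInjective N e Y → TilingFamily e Y' k L →
  TilingFamily N Y (r * k) (map (pullback e) L)
pullback-family N e r {k = k} N≡re Y↠Y' injective F = record
  { tiles    = All.map⁺ (All.map (pullback-tiling N e e∣N Y↠Y' injective) (tiles F))
  ; has0     = All.map⁺ (All.map (λ {C} C0 → trans (cong C (m<n⇒m%n≡m (>-nonZero⁻¹ e))) C0) (has0 F))
  ; size     = All.map⁺ (All.map (λ {C} |C|≡k → trans (cong (λ n → count n (pullback e C)) N≡re)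
                                                  (trans (count-pullback r e C) (cong (r *_) |C|≡k)))
                                 (size F))
  ; distinct = AllPairs.map⁺ (AllPairs.map widen (distinct F))
  }
  where
  e∣N : e ∣ N
  e∣N = divides r N≡re
  widen : ∀ {A B} → DifferBelow e A B → DifferBelow N (pullback e A) (pullback e B)
  widen {A} {B} (x , x<e , Ax≢Bx) = x , <-≤-trans x<e (∣⇒≤ e∣N) ,
    λ eq → Ax≢Bx (trans (sym (cong A (m<n⇒m%n≡m x<e))) (trans eq (cong B (m<n⇒m%n≡m x<e))))

-- Representatives are chosen for the nonzero elements only, so that every lift contains 0.
lifts : ℕ → (e : ℕ) .{{_ : NonZero e}} → (ℕ → Bool) → List (ℕ → Bool)
lifts q e C = map (lift e C) (choices q (remove0 C) e)

all-lifts : ∀ q e C {P : (ℕ → Bool) → Set} .{{_ : NonZero e}} → 0 < q →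
  (∀ {f} → BoundedOn q (remove0 C) f → P (lift e C f)) → All P (lifts q e C)
all-lifts q e C 0<q p = All.map⁺ (All.map p (choices-bounded q (remove0 C) e 0<q))

length-lifts : ∀ q e C .{{_ : NonZero e}} → C 0 ≡ true → length (lifts q e C) ≡ q ^ (count e C ∸ 1)
length-lifts q e C C0 = begin
  length (lifts q e C)                  ≡⟨ length-map (lift e C) (choices q (remove0 C) e) ⟩
  length (choices q (remove0 C) e)      ≡⟨ length-choices q (remove0 C) e ⟩
  q ^ count e (remove0 C)               ≡⟨ cong (q ^_) (count-remove0 e C (>-nonZero⁻¹ e) C0) ⟩
  q ^ (count e C ∸ 1)                   ∎
  where open ≡-Reasoning

lifts-distinct : ∀ N e q {L} .{{_ : NonZero e}} → N ≡ q * e → 0 < q →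
  AllPairs (DifferBelow e) L → AllPairs (DifferBelow N) (concatMap (lifts q e) L)
lifts-distinct N e q {L} N≡qe 0<q distinct =
  AllPairs.concat⁺ (All.map⁺ (All.universal sameBase L)) (AllPairs.map⁺ (AllPairs.map differentBases distinct))
  where
  sameBase : ∀ C → AllPairs (DifferBelow N) (lifts q e C)
  sameBase C = AllPairs.map⁺ (AllPairs.map
    (λ {f} {g} ((f<q , _) , _ , (r , r<e , C∖0r , fr≢gr)) →
       lift-differ N e q {C} {C} {f} {g} N≡qe r<e (f<q r) (proj₁ (∧-true⁻ {C r} C∖0r)) (inj₂ (fr≢gr ∘ sym)))
    (allPairs-with-all (choices-bounded q (remove0 C) e 0<q) (choices-distinct q (remove0 C) e)))
  differentBases : ∀ {C C'} → DifferBelow e C C' → All (λ D → All (DifferBelow N D) (lifts q e C')) (lifts q e C)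
  differentBases {C} {C'} (r , r<e , Cr≢C'r) =
    all-lifts q e C 0<q λ {f} (f<q , _) → all-lifts q e C' 0<q λ {g} (g<q , _) → separate f g (f<q r) (g<q r)
    where
    separate : ∀ f g → f r < q → g r < q → DifferBelow N (lift e C f) (lift e C' g)
    separate f g fr<q gr<q with C r in Cr | C' r in C'r
    ... | true  | false = lift-differ N e q {C} {C'} {f} {g} N≡qe r<e fr<q Cr (inj₁ C'r)
    ... | false | true  = differBelow-sym (lift-differ N e q {C'} {C} {g} {f} N≡qe r<e gr<q C'r (inj₁ Cr))
    ... | true  | true  = ⊥-elim (Cr≢C'r refl)
    ... | false | false = ⊥-elim (Cr≢C'r refl)

lift-family : ∀ N e q {Y Y' k L} .{{_ : NonZero N}} .{{_ : NonZero e}} → N ≡ q * e →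
  IsQuotient N e Y Y' → PeriodicBy N e Y → TilingFamily e Y' k L →
  TilingFamily N Y k (concatMap (lifts q e) L) × length (concatMap (lifts q e) L) ≡ length L * q ^ (k ∸ 1)
lift-family N e q {k = k} {L} N≡qe Y↠Y' periodic F = record
  { tiles    = each (tiles F) λ {C} tiling (f<q , _) → lift-tiling N e q N≡qe Y↠Y' periodic f<q tiling
  ; has0     = each (has0 F) λ {C} {f} C0 (_ , off) →
                 trans (lift-at e C f 0 (>-nonZero⁻¹ e)) (cong₂ (λ b j → b ∧ (j ≡ᵇ 0)) C0 (off 0 (∧-zeroʳ (C 0))))
  ; size     = each (size F) λ {C} {f} |C|≡k (f<q , _) →
                 trans (cong (λ n → count n (lift e C f)) N≡qe) (trans (count-lift q e C f f<q) |C|≡k)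
  ; distinct = lifts-distinct N e q N≡qe 0<q (distinct F)
  } , length-concatMap (lifts q e) (q ^ (k ∸ 1))
        (All.zipWith (λ {C} (C0 , |C|≡k) → trans (length-lifts q e C C0) (cong (λ n → q ^ (n ∸ 1)) |C|≡k))
                     (has0 F , size F))
  where
  0<q : 0 < q
  0<q = n≢0⇒n>0 λ { refl → ≢-nonZero⁻¹ N N≡qe }
  each : ∀ {P : (ℕ → Bool) → Set} {P' : (ℕ → Bool) → Set} {Cs} → All P Cs →
    (∀ {C f} → P C → BoundedOn q (remove0 C) f → P' (lift e C f)) → All P' (concatMap (lifts q e) Cs)
  each all-P p = All.concat⁺ (All.map⁺ (All.map (λ {C} PC → all-lifts q e C 0<q (p PC)) all-P))

lift-family-pow : ∀ N e p a {Y Y' k L s} .{{_ : NonZero N}} .{{_ : NonZero e}} → N ≡ p ^ a * e →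
  IsQuotient N e Y Y' → PeriodicBy N e Y → TilingFamily e Y' k L → length L ≡ p ^ s →
  ∃ λ L' → TilingFamily N Y k L' × length L' ≡ p ^ (a * (k ∸ 1) + s)
lift-family-pow N e p a {k = k} {L} {s} N≡pᵃe Y↠Y' periodic F |L|≡pˢ =
  let F' , |L'| = lift-family N e (p ^ a) N≡pᵃe Y↠Y' periodic F
  in _ , F' , (begin
    length (concatMap (lifts (p ^ a) e) L) ≡⟨ |L'| ⟩
    length L * (p ^ a) ^ (k ∸ 1)      ≡⟨ cong₂ _*_ |L|≡pˢ (^-*-assoc p a (k ∸ 1)) ⟩
    p ^ s * p ^ (a * (k ∸ 1))         ≡⟨ ^-distribˡ-+-* p s _ ⟨
    p ^ (s + a * (k ∸ 1))             ≡⟨ cong (p ^_) (+-comm s _) ⟩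
    p ^ (a * (k ∸ 1) + s)             ∎)
  where open ≡-Reasoning

-- Tilings along an admissible series

m<n⇒1+2m<2n : ∀ {m n} → m < n → 1 + 2 * m < 2 * n
m<n⇒1+2m<2n {m} {n} m<n = subst (_≤ 2 * n) (*-suc 2 m) (*-monoʳ-≤ 2 m<n)

chain-nonZero : ∀ {N t} {d : ℕ → ℕ} .{{_ : NonZero N}} → d 0 ∣ N → (∀ j → j < 2 * t → d (suc j) ∣ d j) →
  ∀ j → j ≤ 2 * t → NonZero (d j)
chain-nonZero {N} {t} {d} d₀∣N chain j j≤2t =
  ≢-nonZero λ dj≡0 → ≢-nonZero⁻¹ N (0∣⇒≡0 (subst (_∣ N) dj≡0 (d∣N j j≤2t)))
  where
  d∣N : ∀ j → j ≤ 2 * t → d j ∣ N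
  d∣N zero    _       = d₀∣N
  d∣N (suc j) 1+j≤2t = ∣-trans (chain j 1+j≤2t) (d∣N j (<⇒≤ 1+j≤2t))

sumFrom : (ℕ → ℕ) → ℕ → ℕ → ℕ
sumFrom g a zero    = 0
sumFrom g a (suc u) = g a + sumFrom g (suc a) u

-- log_p of the number of lifts of a tiling of size k j across a step of index p^(a j)
gain : (ℕ → ℕ) → (ℕ → ℕ) → ℕ → ℕ
gain a k j = a j * (k j ∸ 1)

-- Level i consists of tilings of Z_N/H_{2i} (H_j = ⟨d j⟩); level i + 1 is lifted across
-- H_{2i+1} ≤ H_{2i+2} and then pulled back along H_{2i} ≤ H_{2i+1}.
module _ {N : ℕ} .{{_ : NonZero N}} {Y : ℕ → Bool} (Y0 : Y 0 ≡ true) {t : ℕ} {d : ℕ → ℕ}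
  (d₀∣N : d 0 ∣ N) (chain : ∀ j → j < 2 * t → d (suc j) ∣ d j) (top : d (2 * t) ≡ 1)
  (T : T123 N Y t d) {p : ℕ} {a k : ℕ → ℕ}
  (k-step : ∀ i → i < t → k i * d (1 + 2 * i) ≡ k (suc i) * d (2 * i))
  (a-step : ∀ i → i < t → d (1 + 2 * i) ≡ p ^ a (suc i) * d (2 + 2 * i))
  (k-top : k t ≡ 1)
  where

  private
    Q : ℕ → ℕ → Bool
    Q j = quot N (d j) Y

    nonZero-d : ∀ j → j ≤ 2 * t → NonZero (d j)
    nonZero-d = chain-nonZero {t = t} d₀∣N chain

    Q-step : ∀ j → (j<2t : j < 2 * t) → IsQuotient (d j) (d (suc j)) {{nonZero-d (suc j) j<2t}} (Q j) (Q (suc j))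
    Q-step j j<2t = isQuotient-factor {{nonZero-d j (<⇒≤ j<2t)}} {{nonZero-d (suc j) j<2t}} (chain j j<2t)
      (quot-isQuotient N (d j) Y {{nonZero-d j (<⇒≤ j<2t)}})
      (quot-isQuotient N (d (suc j)) Y {{nonZero-d (suc j) j<2t}})

    tower-step : ∀ i → i < t → ∀ {L s} →
      TilingFamily (d (2 + 2 * i)) (Q (2 + 2 * i)) (k (suc i)) L → length L ≡ p ^ s →
      ∃ λ L' → TilingFamily (d (2 * i)) (Q (2 * i)) (k i) L' × length L' ≡ p ^ (gain a k (suc i) + s)
    tower-step i i<t F₂ |L₂| =
      let L₁ , F₁ , |L₁| = lift-family-pow e₁ e₂ p (a (suc i)) (a-step i i<t) (Q-step (1 + 2 * i) 1+2i<2t)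
                             (λ b b<e₁ → proj₂ (proj₁ (proj₂ T) i i<t b b<e₁)) F₂ |L₂|
      in map (pullback e₁) L₁ ,
         subst (λ κ → TilingFamily e₀ (Q (2 * i)) κ (map (pullback e₁) L₁)) (sym k-ratio)
           (pullback-family e₀ e₁ r e₀≡re₁ (Q-step (2 * i) 2i<2t) (proj₁ T i i<t) F₁) ,
         trans (length-map (pullback e₁) L₁) |L₁|
      where
      2i<2t : 2 * i < 2 * t
      2i<2t = *-monoʳ-< 2 i<t
      1+2i<2t : 1 + 2 * i < 2 * t
      1+2i<2t = m<n⇒1+2m<2n i<t
      e₀ e₁ e₂ : ℕ
      e₀ = d (2 * i)
      e₁ = d (1 + 2 * i)
      e₂ = d (2 + 2 * i)
      instance
        _ : NonZero e₀
        _ = nonZero-d (2 * i) (<⇒≤ 2i<2t)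
        _ : NonZero e₁
        _ = nonZero-d (1 + 2 * i) (<⇒≤ 1+2i<2t)
        _ : NonZero e₂
        _ = nonZero-d (2 + 2 * i) 1+2i<2t
      r : ℕ
      r = _∣_.quotient (chain (2 * i) 2i<2t)
      e₀≡re₁ : e₀ ≡ r * e₁
      e₀≡re₁ = _∣_.equality (chain (2 * i) 2i<2t)
      k-ratio : k i ≡ r * k (suc i)
      k-ratio = *-cancelʳ-≡ (k i) (r * k (suc i)) e₁ (begin
        k i * e₁               ≡⟨ k-step i i<t ⟩
        k (suc i) * e₀         ≡⟨ cong (k (suc i) *_) e₀≡re₁ ⟩
        k (suc i) * (r * e₁)   ≡⟨ *-assoc (k (suc i)) r e₁ ⟨
        k (suc i) * r * e₁     ≡⟨ cong (_* e₁) (*-comm (k (suc i)) r) ⟩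
        r * k (suc i) * e₁     ∎)
        where open ≡-Reasoning

    level : ∀ u i → i + u ≡ t →
      ∃ λ L → TilingFamily (d (2 * i)) (Q (2 * i)) (k i) L × length L ≡ p ^ sumFrom (gain a k) (suc i) u
    level zero i i+0≡t with trans (sym (+-identityʳ i)) i+0≡t
    ... | refl rewrite top | k-top = _ , singleton-family (isQuotient-0 (quot-isQuotient N 1 Y) Y0) , refl
    level (suc u) i i+1+u≡t =
      let L , F , |L| = level u (suc i) (trans (sym (+-suc i u)) i+1+u≡t)
      in tower-step i (subst (i <_) i+1+u≡t (m<m+n i z<s))
           (subst (λ j → TilingFamily (d j) (Q j) (k (suc i)) L) (*-suc 2 i) F) |L|

  tower-family : ∃ λ L → TilingFamily (d 0) (Q 0) (k 0) L × length L ≡ p ^ sumFrom (gain a k) 1 t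
  tower-family = level t 0 refl

admissible-family : ∀ {n X t d p} {a k : ℕ → ℕ} .{{_ : NonZero n}} → X 0 ≡ true → Admissible n X t d →
  n ≡ p ^ a 0 * d 0 →
  (∀ i → i < t → k i * d (1 + 2 * i) ≡ k (suc i) * d (2 * i)) →
  (∀ i → i < t → d (1 + 2 * i) ≡ p ^ a (suc i) * d (2 + 2 * i)) →
  k t ≡ 1 →
  ∃ λ L → TilingFamily n X (k 0) L × length L ≡ p ^ sumFrom (gain a k) 0 (suc t)
admissible-family {n} {X} {t} {d} {p} {a} {k} X0 adm n≡pᵃd₀ k-step a-step k-top =
  -- in case (a) H_0 = {0}, and the final lift has index 1
  [ (λ (d₀≡n , _ , T) → lift-tower X0 d0∣n T (quot-isQuotient n (d 0) X)
                          (subst (λ e → PeriodicBy n e X) (sym d₀≡n) (periodicBy-self n X)))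
  , (λ (_ , periods , T) → lift-tower (isQuotient-0 (quot-isQuotient n (d 0) X) X0) ∣-refl T
       (isQuotient-trans ∣-refl (quot-isQuotient n (d 0) X) (quot-isQuotient (d 0) (d 0) (quot n (d 0) X)))
       (λ b b<n → proj₂ (periods b b<n)))
  ]′ cases
  where
  open Admissible adm
  instance
    _ : NonZero (d 0)
    _ = chain-nonZero {t = t} d0∣n chain 0 z≤n
  lift-tower : ∀ {N Y} .{{_ : NonZero N}} → Y 0 ≡ true → d 0 ∣ N → T123 N Y t d →
    IsQuotient n (d 0) X (quot N (d 0) Y) → PeriodicBy n (d 0) X →
    ∃ λ L → TilingFamily n X (k 0) L × length L ≡ p ^ sumFrom (gain a k) 0 (suc t)
  lift-tower Y0 d₀∣N T X↠Y periodic =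
    let _ , F₀ , |L₀| = tower-family Y0 d₀∣N chain top T {a = a} {k} k-step a-step k-top
    in lift-family-pow n (d 0) p (a 0) n≡pᵃd₀ X↠Y periodic F₀ |L₀|

-- The associated sequences and the exponent

p^a≡p^b*q⇒b≤a×q≡p^[a∸b] : ∀ {p} a b q → 1 < p → p ^ a ≡ p ^ b * q → b ≤ a × q ≡ p ^ (a ∸ b)
p^a≡p^b*q⇒b≤a×q≡p^[a∸b] {p} a b q 1<p pᵃ≡pᵇq =
  b≤a , *-cancelˡ-≡ q (p ^ (a ∸ b)) (p ^ b) {{m^n≢0 p b}} (begin
    p ^ b * q              ≡⟨ pᵃ≡pᵇq ⟨
    p ^ a                  ≡⟨ cong (p ^_) (m+[n∸m]≡n b≤a) ⟨
    p ^ (b + (a ∸ b))      ≡⟨ ^-distribˡ-+-* p b (a ∸ b) ⟩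
    p ^ b * p ^ (a ∸ b)    ∎)
  where
  open ≡-Reasoning
  instance
    _ : NonZero p
    _ = >-nonZero (<-trans z<s 1<p)
    _ : NonZero q
    _ = ≢-nonZero λ q≡0 → ≢-nonZero⁻¹ (p ^ a) {{m^n≢0 p a}}
          (trans pᵃ≡pᵇq (trans (cong (p ^ b *_) q≡0) (*-zeroʳ (p ^ b))))
  b≤a : b ≤ a
  b≤a = ≮⇒≥ λ a<b → <⇒≱ (^-monoʳ-< p 1<p a<b) (≤-trans (m≤m*n (p ^ b) q) (≤-reflexive (sym pᵃ≡pᵇq)))

^-index : ∀ {p x y e D} .{{_ : NonZero e}} → 1 < p → e ∣ D → p ^ x * e ≡ p ^ y * D →
  y ≤ x × D ≡ p ^ (x ∸ y) * e
^-index {p} {x} {y} {e} {D} 1<p (divides q D≡qe) pˣe≡pʸD =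
  let y≤x , q≡pˣ⁻ʸ = p^a≡p^b*q⇒b≤a×q≡p^[a∸b] x y q 1<p (*-cancelʳ-≡ (p ^ x) (p ^ y * q) e
                       (trans pˣe≡pʸD (trans (cong (p ^ y *_) D≡qe) (sym (*-assoc (p ^ y) q e)))))
  in y≤x , trans D≡qe (cong (_* e) q≡pˣ⁻ʸ)

-- h_{j−1} − h_j = log_p |H_{2j} : H_{2j−1}| for j ≥ 1, and ℓ − h_0 = log_p |G : H_0|
drops : ℕ → (ℕ → ℕ) → ℕ → ℕ
drops ℓ h j = hPrev ℓ h j ∸ h j

module AssocSeqsIndices {p ℓ m n t} {d h k : ℕ → ℕ} (1<p : 1 < p) (n≡pˡm : n ≡ p ^ ℓ * m) (d₀∣n : d 0 ∣ n)
  (chain : ∀ j → j < 2 * t → d (suc j) ∣ d j) (nonZero-d : ∀ j → j ≤ 2 * t → NonZero (d j))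
  (assoc : AssocSeqs p m t d h k) where

  private
    steps : ∀ i → i < t → (k i * d (1 + 2 * i) ≡ k (suc i) * d (2 * i))
                        × (p ^ h i * d (2 + 2 * i) ≡ p ^ h (suc i) * d (1 + 2 * i))
    steps = proj₂ (proj₂ assoc)

  even-term : ∀ i → i ≤ t → d (2 * i) ≡ p ^ h i * k i
  even-term zero    _   = trans (proj₁ (proj₂ assoc)) (cong (p ^ h 0 *_) (sym (proj₁ assoc)))
  even-term (suc i) i<t = *-cancelˡ-≡ _ _ (d (2 * i)) {{nonZero-d (2 * i) (*-monoʳ-≤ 2 (<⇒≤ i<t))}} (begin
    d (2 * i) * d (2 * suc i)                 ≡⟨ cong₂ _*_ (even-term i (<⇒≤ i<t)) (cong d (*-suc 2 i)) ⟩
    p ^ h i * k i * d (2 + 2 * i)             ≡⟨ *-CS.xy∙z≈y∙xz (p ^ h i) (k i) (d (2 + 2 * i)) ⟩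
    k i * (p ^ h i * d (2 + 2 * i))           ≡⟨ cong (k i *_) (proj₂ (steps i i<t)) ⟩
    k i * (p ^ h (suc i) * d (1 + 2 * i))     ≡⟨ *-CS.x∙yz≈y∙xz (k i) (p ^ h (suc i)) (d (1 + 2 * i)) ⟩
    p ^ h (suc i) * (k i * d (1 + 2 * i))     ≡⟨ cong (p ^ h (suc i) *_) (proj₁ (steps i i<t)) ⟩
    p ^ h (suc i) * (k (suc i) * d (2 * i))   ≡⟨ *-CS.x∙yz≈z∙xy (p ^ h (suc i)) (k (suc i)) (d (2 * i)) ⟩
    d (2 * i) * (p ^ h (suc i) * k (suc i))   ∎)
    where open ≡-Reasoning

  k-step : ∀ i → i < t → k i * d (1 + 2 * i) ≡ k (suc i) * d (2 * i)
  k-step i i<t = proj₁ (steps i i<t)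

  k-top : d (2 * t) ≡ 1 → k t ≡ 1
  k-top top = m*n≡1⇒n≡1 (p ^ h t) (k t) (trans (sym (even-term t ≤-refl)) top)

  top-index : h 0 ≤ ℓ × n ≡ p ^ drops ℓ h 0 * d 0
  top-index = ^-index {{nonZero-d 0 z≤n}} 1<p d₀∣n (begin
    p ^ ℓ * d 0                 ≡⟨ cong (p ^ ℓ *_) (proj₁ (proj₂ assoc)) ⟩
    p ^ ℓ * (p ^ h 0 * m)       ≡⟨ *-CS.x∙yz≈y∙xz (p ^ ℓ) (p ^ h 0) m ⟩
    p ^ h 0 * (p ^ ℓ * m)       ≡⟨ cong (p ^ h 0 *_) n≡pˡm ⟨
    p ^ h 0 * n                 ∎)
    where open ≡-Reasoning

  step-index : ∀ i → i < t → h (suc i) ≤ h i × d (1 + 2 * i) ≡ p ^ drops ℓ h (suc i) * d (2 + 2 * i)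
  step-index i i<t = ^-index {{nonZero-d (2 + 2 * i) (m<n⇒1+2m<2n i<t)}} 1<p
    (chain (1 + 2 * i) (m<n⇒1+2m<2n i<t)) (proj₂ (steps i i<t))

  h-drops : ∀ i → i < t → h i ≤ hPrev ℓ h i
  h-drops zero    _     = proj₁ top-index
  h-drops (suc i) 1+i<t = proj₁ (step-index i (<-trans (n<1+n i) 1+i<t))

[x∸y]*k+y≤x+[x∸y]*[k∸1] : ∀ {x y} k → y ≤ x → (x ∸ y) * k + y ≤ x + (x ∸ y) * (k ∸ 1)
[x∸y]*k+y≤x+[x∸y]*[k∸1] {x} {y} zero    y≤x =
  ≤-trans (≤-reflexive (cong (_+ y) (*-zeroʳ (x ∸ y)))) (≤-trans y≤x (m≤m+n x _))
[x∸y]*k+y≤x+[x∸y]*[k∸1] {x} {y} (suc k) y≤x = ≤-reflexive (begin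
  (x ∸ y) * suc k + y             ≡⟨ cong (_+ y) (*-suc (x ∸ y) k) ⟩
  (x ∸ y) + (x ∸ y) * k + y       ≡⟨ +-CS.xy∙z≈xz∙y (x ∸ y) _ y ⟩
  (x ∸ y) + y + (x ∸ y) * k       ≡⟨ cong (_+ (x ∸ y) * k) (m∸n+n≡m y≤x) ⟩
  x + (x ∸ y) * k                 ∎)
  where open ≡-Reasoning

sumBelow-telescope : ∀ ℓ h k u → (∀ i → i < u → h i ≤ hPrev ℓ h i) →
  sumBelow u (λ i → drops ℓ h i * k i) + hPrev ℓ h u ≤ sumBelow u (gain (drops ℓ h) k) + ℓ
sumBelow-telescope ℓ h k zero    _       = ≤-refl
sumBelow-telescope ℓ h k (suc u) h-drops = begin
  A + drops ℓ h u * k u + h u           ≡⟨ +-assoc A _ (h u) ⟩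
  A + (drops ℓ h u * k u + h u)         ≤⟨ +-monoʳ-≤ A ([x∸y]*k+y≤x+[x∸y]*[k∸1] (k u) (h-drops u ≤-refl)) ⟩
  A + (hPrev ℓ h u + g u)               ≡⟨ +-assoc A _ (g u) ⟨
  A + hPrev ℓ h u + g u                 ≤⟨ +-monoˡ-≤ (g u) (sumBelow-telescope ℓ h k u λ i i<u → h-drops i (m<n⇒m<1+n i<u)) ⟩
  B + ℓ + g u                           ≡⟨ +-CS.xy∙z≈xz∙y B ℓ (g u) ⟩
  B + g u + ℓ                           ∎
  where
  open ≤-Reasoning
  g : ℕ → ℕ
  g = gain (drops ℓ h) k
  A B : ℕ
  A = sumBelow u (λ i → drops ℓ h i * k i)
  B = sumBelow u g

sumBelow+sumFrom : ∀ g a u → sumBelow a g + sumFrom g a u ≡ sumBelow (a + u) g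
sumBelow+sumFrom g a zero    = trans (+-identityʳ _) (cong (λ n → sumBelow n g) (sym (+-identityʳ a)))
sumBelow+sumFrom g a (suc u) = begin
  sumBelow a g + (g a + sumFrom g (suc a) u)   ≡⟨ +-assoc (sumBelow a g) (g a) _ ⟨
  sumBelow (suc a) g + sumFrom g (suc a) u     ≡⟨ sumBelow+sumFrom g (suc a) u ⟩
  sumBelow (suc a + u) g                       ≡⟨ cong (λ n → sumBelow n g) (+-suc a u) ⟨
  sumBelow (a + suc u) g                       ∎
  where open ≡-Reasoning

exponent≤sumFrom : ∀ ℓ t h k → 1 ≤ t → (∀ i → i < t → h i ≤ hPrev ℓ h i) →
  exponent ℓ t h k ≤ sumFrom (gain (drops ℓ h) k) 0 (suc t)
exponent≤sumFrom ℓ (suc t) h k _ h-drops = begin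
  sumBelow (suc t) (λ i → drops ℓ h i * k i) + h t ∸ ℓ
    ≤⟨ ∸-monoˡ-≤ ℓ (sumBelow-telescope ℓ h k (suc t) h-drops) ⟩
  sumBelow (suc t) g + ℓ ∸ ℓ
    ≡⟨ m+n∸n≡m _ ℓ ⟩
  sumBelow (suc t) g
    ≤⟨ m≤m+n _ (g (suc t)) ⟩
  sumBelow (suc (suc t)) g
    ≡⟨ sumBelow+sumFrom g 0 (suc (suc t)) ⟨
  sumFrom g 0 (suc (suc t))
    ∎
  where
  open ≤-Reasoning
  g : ℕ → ℕ
  g = gain (drops ℓ h) k

-- Counting perfect codes

∈-─⁺ : ∀ {A : Set} {x y : A} {ys} (x∈ys : x ∈ ys) → y ∈ ys → y ≢ x → y ∈ (ys ─ x∈ys)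
∈-─⁺ (here refl)  (here refl)  y≢x = ⊥-elim (y≢x refl)
∈-─⁺ (here refl)  (there y∈ys) _   = y∈ys
∈-─⁺ (there x∈ys) (here refl)  _   = here refl
∈-─⁺ (there x∈ys) (there y∈ys) y≢x = there (∈-─⁺ x∈ys y∈ys y≢x)

unique⊆⇒length≤ : ∀ {A : Set} {xs ys : List A} → Unique xs → All (_∈ ys) xs → length xs ≤ length ys
unique⊆⇒length≤ []                  []                = z≤n
unique⊆⇒length≤ {xs = _ ∷ xs} {ys} (x∉xs ∷ unique) (x∈ys ∷ xs⊆ys) = begin
  suc (length xs)            ≤⟨ s≤s (unique⊆⇒length≤ unique
                                  (All.zipWith (λ (x≢y , y∈ys) → ∈-─⁺ x∈ys y∈ys (x≢y ∘ sym)) (x∉xs , xs⊆ys))) ⟩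
  suc (length (ys ─ x∈ys))   ≡⟨ length-removeAt′ ys _ ⟨
  length ys                  ∎
  where open ≤-Reasoning

bitLists-complete : ∀ bs → bs ∈ bitLists (length bs)
bitLists-complete []           = here refl
bitLists-complete (true  ∷ bs) = ∈-++⁺ˡ (∈-map⁺ (true ∷_) (bitLists-complete bs))
bitLists-complete (false ∷ bs) =
  ∈-++⁺ʳ (map (true ∷_) (bitLists (length bs))) (∈-map⁺ (false ∷_) (bitLists-complete bs))

toSet-applyUpTo : ∀ n C i → i < n → toSet (applyUpTo C n) i ≡ C i
toSet-applyUpTo (suc n) C zero    _   = refl
toSet-applyUpTo (suc n) C (suc i) i<n = toSet-applyUpTo n (C ∘ suc) i (s<s⁻¹ i<n)

tiling⇒isPerfectCode : ∀ n S C → Tiling n (S₀ S) C → IsPerfectCode n S (toSet (applyUpTo C n))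
tiling⇒isPerfectCode n S C tiling v with tiling (toℕ v) (toℕ<n v)
... | x , x<n , Cx , Sv-x , unique = count-one n _ x x<n
  (trans (cong₂ _∧_ (trans (toSet-applyUpTo n C x x<n) Cx) Sv-x) refl)
  λ y y<n hit → let Dy , Sv-y = ∧-true⁻ {toSet (applyUpTo C n) y} hit
                in unique y y<n (trans (sym (toSet-applyUpTo n C y y<n)) Dy) Sv-y

family≤c : ∀ n S {k L} → 0 < n → TilingFamily n (S₀ S) k L → length L ≤ c n S
family≤c n S {L = L} 0<n F = begin
  length L                         ≡⟨ length-map (λ C → applyUpTo C n) L ⟨
  length (map (λ C → applyUpTo C n) L)
    ≤⟨ unique⊆⇒length≤ (AllPairs.map⁺ (AllPairs.map distinct-lists (distinct F)))
                       (All.map⁺ (All.zipWith counted (tiles F , has0 F))) ⟩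
  c n S                            ∎
  where
  open ≤-Reasoning
  distinct-lists : ∀ {A B} → DifferBelow n A B → applyUpTo A n ≢ applyUpTo B n
  distinct-lists {A} {B} (x , x<n , Ax≢Bx) eq =
    Ax≢Bx (trans (sym (toSet-applyUpTo n A x x<n))
                 (trans (cong (λ bs → toSet bs x) eq) (toSet-applyUpTo n B x x<n)))
  counted : ∀ {C} → Tiling n (S₀ S) C × C 0 ≡ true →
    applyUpTo C n ∈ filter (λ bs → isPerfectCode? n S (toSet bs) ×-dec (toSet bs 0 ≟ᵇ true)) (bitLists n)
  counted {C} (tiling , C0) = ∈-filter⁺ (λ bs → isPerfectCode? n S (toSet bs) ×-dec (toSet bs 0 ≟ᵇ true))
    (subst (λ l → applyUpTo C n ∈ bitLists l) (length-applyUpTo C n) (bitLists-complete (applyUpTo C n)))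
    (tiling⇒isPerfectCode n S C tiling , trans (toSet-applyUpTo n C 0 0<n) C0)

theorem1p4 : ∀ (p ℓ m n : ℕ) (S : ℕ → Bool) →
    Prime p → 1 ≤ ℓ → 2 ≤ m → n ≡ p ^ ℓ * m →
    IsConnectionSet n S → Connected n S → count n S ≡ p ^ ℓ ∸ 1 →
    Pyramidal n (S₀ S) →
    ∀ (t : ℕ) (d : ℕ → ℕ) → LongestAdmissible n (S₀ S) t d →
    ∀ (h k : ℕ → ℕ) → AssocSeqs p m t d h k →
    p ^ exponent ℓ t h k ≤ c n S
theorem1p4 p ℓ m n S p-prime _ 2≤m n≡pˡm _ _ _ _ t d (adm , _) h k assoc =
  let L , F , |L| = admissible-family {a = drops ℓ h} {k} (∨-zeroʳ (S 0)) adm (proj₂ top-index) k-step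
                      (λ i i<t → proj₂ (step-index i i<t)) (k-top top)
  in begin
    p ^ exponent ℓ t h k                        ≤⟨ ^-monoʳ-≤ p (exponent≤sumFrom ℓ t h k t≥1 h-drops) ⟩
    p ^ sumFrom (gain (drops ℓ h) k) 0 (suc t)  ≡⟨ |L| ⟨
    length L                                    ≤⟨ family≤c n S (>-nonZero⁻¹ n) F ⟩
    c n S                                       ∎
  where
  open Admissible adm
  open ≤-Reasoning
  1<p : 1 < p
  1<p = nonTrivial⇒n>1 p {{prime⇒nonTrivial p-prime}}
  instance
    _ : NonZero p
    _ = >-nonZero (<-trans z<s 1<p)
    _ : NonZero n
    _ = subst NonZero (sym n≡pˡm) (m*n≢0 (p ^ ℓ) m {{m^n≢0 p ℓ}} {{>-nonZero (<-trans z<s 2≤m)}})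
  open AssocSeqsIndices {ℓ = ℓ} {h = h} {k} 1<p n≡pˡm d0∣n chain (chain-nonZero {t = t} d0∣n chain) assoc
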